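{- Let $p,q,p',q'$ be primes. Then $p:q::_m p':q'$ holds if and only if ($p=q$ and $p'=q'$) or ($p=p'$ and $q=q'$), where $::_m$ is the monolinear analogical proportion relation in $(\mathbb N,\cdot,\mathbb N)$.
   Context: $(\mathbb N,\cdot,\mathbb N)$ is the algebra of natural numbers with multiplication and a constant symbol for every natural number. A justification is a pair of terms $s\to t$ with every variable of $t$ occurring in $s$; $\uparrow(a\to b)$ is the set of justifications with $a=s(\mathbf o)$, $b=t(\mathbf o)$ (evaluated in the algebra) for some assignment $\mathbf o$ of naturals to the variables. $\uparrow^m(a\to b)$ keeps those whose terms contain only a single fixed variable $x$, occurring at most once on each side. $\uparrow^m(a\to b:\!\cdot\,c\to d):=\uparrow^m(a\to b)\cap\uparrow^m(c\to d)$; a monolinear justification is trivial if it lies in all such sets. $a\to b:\!\cdot_m\,c\to d$ holds iff either (a) $\uparrow^m(a\to b)\cup\uparrow^m(c\to d)$ consists only of trivial justifications, or (b) with $J_e$ denoting $\uparrow^m(a\to b:\!\cdot\,c\to e)$ minus trivial justifications, $J_d\neq\emptyset$ and $J_d\subseteq J_{d'}$ implies $J_{d'}\subseteq J_d$ for every $d'\in\mathbb N$. Then $a:b::_m c:d$ iff $a\to b:\!\cdot_m\,c\to d$, $b\to a:\!\cdot_m\,d\to c$, $c\to d:\!\cdot_m\,a\to b$, $d\to c:\!\cdot_m\,b\to a$ all hold. -}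

module Defs where

open import Data.Nat using (ℕ; _+_; _*_; _≤_)
open import Data.Product using (Σ; _×_; ∃; ∃-syntax)
open import Data.Sum using (_⊎_)
open import Relation.Nullary using (¬_)
open import Relation.Binary.PropositionalEquality using (_≡_)

data Term : Set where
  x     : Term
  const : ℕ → Term
  _·_   : Term → Term → Term

occ : Term → ℕ
occ x         = 1
occ (const _) = 0
occ (s · t)   = occ s + occ t

⟦_⟧ : Term → ℕ → ℕ
⟦ x ⟧       o = o
⟦ const n ⟧ o = n
⟦ s · t ⟧   o = ⟦ s ⟧ o * ⟦ t ⟧ o

record Just : Set where
  constructor _⇒_
  field
    lhs : Term
    rhs : Term
open Just public

-- monolinear justification: only variable x, at most once on each side,
-- and every variable of the right side occurs in the left side.
IsMono : Just → Set
IsMono (s ⇒ t) = occ s ≤ 1 × occ t ≤ 1 × (occ t ≡ 1 → occ s ≡ 1)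

Up : ℕ → ℕ → Just → Set
Up a b (s ⇒ t) = IsMono (s ⇒ t) × ∃[ o ] (⟦ s ⟧ o ≡ a × ⟦ t ⟧ o ≡ b)

Up2 : ℕ → ℕ → ℕ → ℕ → Just → Set
Up2 a b c d j = Up a b j × Up c d j

Trivial : Just → Set
Trivial j = IsMono j × (∀ a b c d → Up2 a b c d j)

Jset : ℕ → ℕ → ℕ → ℕ → Just → Set
Jset a b c e j = Up2 a b c e j × ¬ Trivial j

_⊆J_ : (Just → Set) → (Just → Set) → Set
P ⊆J Q = ∀ j → P j → Q j

ArrowProp : ℕ → ℕ → ℕ → ℕ → Set
ArrowProp a b c d =
  (∀ j → Up a b j ⊎ Up c d j → Trivial j)
  ⊎ ((∃[ j ] Jset a b c d j)
     × (∀ d' → Jset a b c d ⊆J Jset a b c d' → Jset a b c d' ⊆J Jset a b c d))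

AP : ℕ → ℕ → ℕ → ℕ → Set
AP a b c d = ArrowProp a b c d × ArrowProp b a d c × ArrowProp c d a b × ArrowProp d c b a

module Submission where

open import Defs
open import Data.Nat using (ℕ; _+_; _*_; _^_; z≤n; s≤s; NonZero)
open import Data.Nat.Properties
open import Data.Nat.Divisibility using (_∣_; divides; m∣m*n)
open import Data.Nat.Primality using (Prime; prime⇒irreducible; prime⇒nonZero; prime⇒nonTrivial)
open import Data.Nat.Base using (nonTrivial⇒≢1)
open import Data.Product using (_×_; _,_; ∃-syntax)
open import Data.Sum using (_⊎_; inj₁; inj₂)
open import Data.Empty using (⊥-elim)
open import Function.Bundles using (_⇔_; mk⇔)
open import Relation.Nullary using (¬_)
open import Relation.Binary.PropositionalEquality

-- Every term evaluates to a monomial k·oⁱ, so a monolinear justification s → t acts as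
-- k → l, k·o → l or k·o → l·o.  None is trivial, and one justifying both p → q and p' → q'
-- gives q = q' or (p, q, p', q') = (k o, l o, k o', l o'); for primes the latter forces
-- k = 1 (so p = q, p' = q') or o = 1 (so p = p', q = q').  Conversely const p → const q and
-- x → x realise these two patterns, and each fixes its right-hand value from the left one,
-- which gives the maximality required of J_d.

⟦⟧-monomial : ∀ s o → ⟦ s ⟧ o ≡ ⟦ s ⟧ 1 * o ^ occ s
⟦⟧-monomial x         o = sym (trans (*-identityˡ (o * 1)) (*-identityʳ o))
⟦⟧-monomial (const n) o = sym (*-identityʳ n)
⟦⟧-monomial (s · t)   o = begin
  ⟦ s ⟧ o * ⟦ t ⟧ o                                   ≡⟨ cong₂ _*_ (⟦⟧-monomial s o) (⟦⟧-monomial t o) ⟩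
  (⟦ s ⟧ 1 * o ^ occ s) * (⟦ t ⟧ 1 * o ^ occ t)       ≡⟨ [m*n]*[o*p]≡[m*o]*[n*p] (⟦ s ⟧ 1) _ (⟦ t ⟧ 1) _ ⟩
  (⟦ s ⟧ 1 * ⟦ t ⟧ 1) * (o ^ occ s * o ^ occ t)       ≡⟨ cong (⟦ s ⟧ 1 * ⟦ t ⟧ 1 *_) (^-distribˡ-+-* o (occ s) (occ t)) ⟨
  (⟦ s ⟧ 1 * ⟦ t ⟧ 1) * o ^ (occ s + occ t)           ∎
  where open ≡-Reasoning

record LinearlyRelated (a b c d : ℕ) : Set where
  constructor linear
  field
    k l o o' : ℕ
    ko≡a  : k * o ≡ a
    lo≡b  : l * o ≡ b
    ko'≡c : k * o' ≡ c
    lo'≡d : l * o' ≡ d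

Up2⇒≡∨linear : ∀ {a b c d} j → Up2 a b c d j → b ≡ d ⊎ LinearlyRelated a b c d
Up2⇒≡∨linear {b = b} {d = d} (s ⇒ t) (((_ , occt≤1 , t⇒s) , o , sa , tb) , (_ , o' , sc , td))
  with n≤1⇒n≡0∨n≡1 occt≤1
... | inj₁ occt≡0 = inj₁ (begin
  b                     ≡⟨ tb ⟨
  ⟦ t ⟧ o               ≡⟨ ⟦⟧-monomial t o ⟩
  ⟦ t ⟧ 1 * o ^ occ t   ≡⟨ cong (λ i → ⟦ t ⟧ 1 * o ^ i) occt≡0 ⟩
  ⟦ t ⟧ 1 * 1           ≡⟨ cong (λ i → ⟦ t ⟧ 1 * o' ^ i) occt≡0 ⟨
  ⟦ t ⟧ 1 * o' ^ occ t  ≡⟨ ⟦⟧-monomial t o' ⟨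
  ⟦ t ⟧ o'              ≡⟨ td ⟩
  d                     ∎)
  where open ≡-Reasoning
... | inj₂ occt≡1 = inj₂ (linear (⟦ s ⟧ 1) (⟦ t ⟧ 1) o o'
  (linear-value s (t⇒s occt≡1) sa) (linear-value t occt≡1 tb)
  (linear-value s (t⇒s occt≡1) sc) (linear-value t occt≡1 td))
  where
  linear-value : ∀ u {o n} → occ u ≡ 1 → ⟦ u ⟧ o ≡ n → ⟦ u ⟧ 1 * o ≡ n
  linear-value u {o} occu≡1 uo≡n = begin
    ⟦ u ⟧ 1 * o          ≡⟨ cong (⟦ u ⟧ 1 *_) (*-identityʳ o) ⟨
    ⟦ u ⟧ 1 * o ^ 1      ≡⟨ cong (λ i → ⟦ u ⟧ 1 * o ^ i) occu≡1 ⟨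
    ⟦ u ⟧ 1 * o ^ occ u  ≡⟨ ⟦⟧-monomial u o ⟨
    ⟦ u ⟧ o              ≡⟨ uo≡n ⟩
    _                    ∎
    where open ≡-Reasoning

-- No justification lies in ↑ᵐ(1 → 0 :· 1 → 1).
¬Trivial : ∀ j → ¬ Trivial j
¬Trivial j (_ , everywhere) with Up2⇒≡∨linear j (everywhere 1 0 1 1)
... | inj₁ ()
... | inj₂ (linear k l o o' ko≡1 lo≡0 _ lo'≡1) with m*n≡1⇒n≡1 k o ko≡1
... | refl with trans (sym (*-identityʳ l)) lo≡0
... | refl with lo'≡1
... | ()

Up-const : ∀ a b → Up a b (const a ⇒ const b)
Up-const a b = (z≤n , z≤n , λ ()) , 0 , refl , refl

Up-x : ∀ a → Up a a (x ⇒ x)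
Up-x a = (s≤s z≤n , s≤s z≤n , λ _ → refl) , a , refl , refl

ArrowProp⇒Up2 : ∀ {a b c d} → ArrowProp a b c d → ∃[ j ] Up2 a b c d j
ArrowProp⇒Up2 {a} {b} (inj₁ allTrivial) =
  ⊥-elim (¬Trivial (const a ⇒ const b) (allTrivial (const a ⇒ const b) (inj₁ (Up-const a b))))
ArrowProp⇒Up2 (inj₂ ((j , up2 , _) , _)) = j , up2

determined⇒ArrowProp : ∀ {a b c d} j → Up2 a b c d j →
  (∀ {d'} → Up c d' j → d' ≡ d) → ArrowProp a b c d
determined⇒ArrowProp {a} {b} {c} {d} j up2 determined = inj₂ ((j , up2 , ¬Trivial j) , maximal)
  where
  maximal : ∀ d' → Jset a b c d ⊆J Jset a b c d' → Jset a b c d' ⊆J Jset a b c d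
  maximal d' J⊆J' with J⊆J' j (up2 , ¬Trivial j)
  ... | (_ , up') , _ with determined up'
  ...   | refl = λ _ j∈J → j∈J

ArrowProp-same : ∀ a b → ArrowProp a b a b
ArrowProp-same a b = determined⇒ArrowProp (const a ⇒ const b) (Up-const a b , Up-const a b)
  λ { (_ , _ , _ , b≡d') → sym b≡d' }

ArrowProp-identity : ∀ a c → ArrowProp a a c c
ArrowProp-identity a c = determined⇒ArrowProp (x ⇒ x) (Up-x a , Up-x c)
  λ { (_ , _ , o≡c , o≡d') → trans (sym o≡d') o≡c }

LinearlyRelated-≡ : ∀ {a b d} .{{_ : NonZero a}} → LinearlyRelated a b a d → b ≡ d
LinearlyRelated-≡ {{a≢0}} (linear k l o o' ko≡a lo≡b ko'≡a lo'≡d) = begin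
  _       ≡⟨ lo≡b ⟨
  l * o   ≡⟨ cong (l *_) o≡o' ⟩
  l * o'  ≡⟨ lo'≡d ⟩
  _       ∎
  where
  open ≡-Reasoning
  instance
    k≢0 : NonZero k
    k≢0 = m*n≢0⇒m≢0 k {{subst NonZero (sym ko≡a) a≢0}}
  o≡o' : o ≡ o'
  o≡o' = *-cancelˡ-≡ o o' k (trans ko≡a (sym ko'≡a))

prime∣prime⇒≡ : ∀ {p q} → Prime p → Prime q → p ∣ q → p ≡ q
prime∣prime⇒≡ pp pq p∣q with prime⇒irreducible pq p∣q
... | inj₁ p≡1 = ⊥-elim (nonTrivial⇒≢1 {{prime⇒nonTrivial pp}} p≡1)
... | inj₂ p≡q = p≡q

common-multiple-of-primes : ∀ {m p q c d} → Prime p → Prime q →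
  m * p ≡ q → m * c ≡ d → p ≡ q × c ≡ d
common-multiple-of-primes {m} {p} {c = c} pp pq mp≡q mc≡d
  with prime∣prime⇒≡ pp pq (divides m (sym mp≡q))
... | refl = refl , trans (sym (*-identityˡ c)) (trans (cong (_* c) (sym m≡1)) mc≡d)
  where
  instance _ = prime⇒nonZero pp
  m≡1 : m ≡ 1
  m≡1 = *-cancelʳ-≡ m 1 p (trans mp≡q (sym (*-identityˡ p)))

LinearlyRelated-primes : ∀ {p q p' q'} → Prime p → Prime q → Prime p' →
  LinearlyRelated p q p' q' → (p ≡ q × p' ≡ q') ⊎ (p ≡ p' × q ≡ q')
LinearlyRelated-primes {p} {q} pp pq pp' (linear k l o o' ko≡p lo≡q ko'≡p' lo'≡q')
  with prime⇒irreducible pp (subst (k ∣_) ko≡p (m∣m*n o))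
... | inj₁ refl = inj₁ (common-multiple-of-primes {l} pp pq
  (trans (cong (l *_) (sym (trans (sym (*-identityˡ o)) ko≡p))) lo≡q)
  (trans (cong (l *_) (sym (trans (sym (*-identityˡ o')) ko'≡p'))) lo'≡q'))
... | inj₂ refl = inj₂ (common-multiple-of-primes {o'} pp pp'
  (trans (*-comm o' k) ko'≡p')
  (trans (*-comm o' q) (trans (cong (_* o') (sym l≡q)) lo'≡q')))
  where
  instance _ = prime⇒nonZero pp
  o≡1 : o ≡ 1
  o≡1 = *-cancelˡ-≡ o 1 k (trans ko≡p (sym (*-identityʳ k)))
  l≡q : l ≡ q
  l≡q = trans (sym (*-identityʳ l)) (trans (cong (l *_) (sym o≡1)) lo≡q)

mainTheorem10 : (p q p' q' : ℕ) → Prime p → Prime q → Prime p' → Prime q' →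
    (AP p q p' q' ⇔ ((p ≡ q × p' ≡ q') ⊎ (p ≡ p' × q ≡ q')))
mainTheorem10 p q p' q' pp pq pp' _ = mk⇔ forward backward
  where
  instance _ = prime⇒nonZero pq
  forward : AP p q p' q' → (p ≡ q × p' ≡ q') ⊎ (p ≡ p' × q ≡ q')
  forward (A₁ , A₂ , _) with ArrowProp⇒Up2 A₁
  ... | j , up2 with Up2⇒≡∨linear j up2
  ...   | inj₂ rel = LinearlyRelated-primes pp pq pp' rel
  ...   | inj₁ refl with ArrowProp⇒Up2 A₂
  ...     | j₂ , up2₂ with Up2⇒≡∨linear j₂ up2₂
  ...       | inj₁ p≡p'  = inj₂ (p≡p' , refl)
  ...       | inj₂ rel   = inj₂ (LinearlyRelated-≡ rel , refl)
  backward : (p ≡ q × p' ≡ q') ⊎ (p ≡ p' × q ≡ q') → AP p q p' q'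
  backward (inj₁ (refl , refl)) =
    ArrowProp-identity p p' , ArrowProp-identity p p' , ArrowProp-identity p' p , ArrowProp-identity p' p
  backward (inj₂ (refl , refl)) =
    ArrowProp-same p q , ArrowProp-same q p , ArrowProp-same p q , ArrowProp-same q p
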